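{- Let $w=a_1\cdots a_n$ be a word over $\{a,b\}$ with $a_1\ne a_n$. If after deleting some $k$ letters of $w$ we obtain an antipalindrome, then we can obtain an antipalindrome by deleting some $l\le k$ letters of $w$ such that the letters $a_1$ and $a_n$ remain undeleted.
   Context: A word is a finite word over the alphabet $\{a,b\}$. A word $c_1\cdots c_m$ is an antipalindrome if $c_i\ne c_{m-i+1}$ for all $i\le m$. Deleting letters from $w$ means passing to a subsequence of $w$ (the remaining letters keep their order). -}

module Defs where

open import Data.Nat using (ℕ; zero; suc)
open import Data.Bool using (Bool; true; false)
open import Data.List using (List; []; _∷_; length)
open import Data.Fin using (Fin; toℕ; opposite)
open import Data.Vec using (Vec; []; _∷_)
open import Relation.Binary.PropositionalEquality using (_≢_)

data Letter : Set where
  a b : Letter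

Word : Set
Word = List Letter

-- c₁⋯c_m is an antipalindrome iff c_i ≠ c_{m-i+1} for all i
-- (0-indexed: position i vs position m-1-i, i.e. `opposite i`)
Antipalindrome : Word → Set
Antipalindrome c = ∀ (i : Fin (length c)) →
  Data.List.lookup c i ≢ Data.List.lookup c (opposite i)

-- a deletion pattern on a word of length n: true = keep, false = delete
-- the subsequence of w kept by the mask
keep : ∀ {n} → Vec Bool n → Vec Letter n → Word
keep [] [] = []
keep (true ∷ m) (x ∷ w) = x ∷ keep m w
keep (false ∷ m) (x ∷ w) = keep m w

deleted : ∀ {n} → Vec Bool n → ℕ
deleted [] = 0
deleted (true ∷ m) = deleted m
deleted (false ∷ m) = suc (deleted m)

-- If nothing is kept, keeping only a₁ and aₙ deletes fewer letters.  Otherwise the kept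
-- antipalindrome has the form x v y with v an antipalindrome (it cannot have length 1).
-- Moving the kept occurrence of x leftwards to a₁ and that of y rightwards to aₙ does not
-- change the number of deletions, and a₁ v aₙ is an antipalindrome because a₁ ≠ aₙ.
module Submission where

open import Defs
open import Data.Nat using (ℕ; zero; suc; pred; _+_; _∸_; _≤_; _<_; s≤s)
open import Data.Nat.Properties
  using (+-suc; +-comm; m≤m+n; m≤n+m; m+n∸m≡n; m+[n∸m]≡n; ≤-reflexive; module ≤-Reasoning)
open import Data.Bool using (Bool; true; false)
open import Data.Vec using (Vec; []; _∷_; head; last)
open import Data.List using ([]; _∷_; _∷ʳ_; length; lookup; initLast; _∷ʳ′_)
open import Data.List.Properties using (∷-injective; ∷-injectiveʳ; ∷ʳ-injectiveˡ; ++-conicalʳ)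
open import Data.Fin using (Fin; toℕ; fromℕ<; opposite)
open import Data.Fin.Properties using (toℕ-fromℕ<; opposite-prop; toℕ<n)
open import Data.Product using (∃; _×_; _,_)
open import Data.Empty using (⊥-elim)
open import Function using (_∘_)
open import Relation.Nullary using (¬_)
open import Relation.Binary.PropositionalEquality
  using (_≡_; _≢_; refl; sym; trans; cong; subst; ≢-sym; module ≡-Reasoning)

private variable
  n : ℕ
  x y : Letter
  u v : Word

infixl 9 _‼_

-- Out-of-range positions read as the junk letter a.
_‼_ : Word → ℕ → Letter
[]       ‼ _     = a
(x ∷ _)  ‼ zero  = x
(_ ∷ xs) ‼ suc i = xs ‼ i

lookup≡‼ : ∀ (c : Word) (f : Fin (length c)) {i} → toℕ f ≡ i → lookup c f ≡ c ‼ i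
lookup≡‼ (x ∷ c) Fin.zero    refl = refl
lookup≡‼ (x ∷ c) (Fin.suc f) refl = lookup≡‼ c f refl

‼-∷ʳ-< : ∀ (v : Word) {i} → i < length v → (v ∷ʳ y) ‼ i ≡ v ‼ i
‼-∷ʳ-< (x ∷ v) {zero}  _         = refl
‼-∷ʳ-< (x ∷ v) {suc i} (s≤s i<n) = ‼-∷ʳ-< v i<n

‼-∷ʳ-length : ∀ (v : Word) → (v ∷ʳ y) ‼ length v ≡ y
‼-∷ʳ-length []      = refl
‼-∷ʳ-length (x ∷ v) = ‼-∷ʳ-length v

length-∷ʳ : ∀ (v : Word) → length (v ∷ʳ y) ≡ suc (length v)
length-∷ʳ []      = refl
length-∷ʳ (x ∷ v) = cong suc (length-∷ʳ v)

1+m+n≡o⇒m<o : ∀ m n {o} → suc (m + n) ≡ o → m < o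
1+m+n≡o⇒m<o m n refl = s≤s (m≤m+n m n)

1+m+n≡o⇒n<o : ∀ m n {o} → suc (m + n) ≡ o → n < o
1+m+n≡o⇒n<o m n refl = s≤s (m≤n+m n m)

toℕ-opposite : ∀ (f : Fin n) {i j} → toℕ f ≡ i → suc (i + j) ≡ n → toℕ (opposite f) ≡ j
toℕ-opposite {n} f {i} {j} refl i+j+1≡n = begin
  toℕ (opposite f)    ≡⟨ opposite-prop f ⟩
  n ∸ suc i           ≡⟨ cong (_∸ suc i) i+j+1≡n ⟨
  suc (i + j) ∸ suc i ≡⟨ m+n∸m≡n i j ⟩
  j                   ∎
  where open ≡-Reasoning

toℕ+toℕ-opposite : ∀ (f : Fin n) → suc (toℕ f + toℕ (opposite f)) ≡ n
toℕ+toℕ-opposite f =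
  trans (cong (λ j → suc (toℕ f + j)) (opposite-prop f)) (m+[n∸m]≡n (toℕ<n f))

-- Positions i and j of a word of length n face each other iff i + j + 1 = n.
Antipalindromeℕ : Word → Set
Antipalindromeℕ c = ∀ i j → suc (i + j) ≡ length c → c ‼ i ≢ c ‼ j

antipalindrome⇒ℕ : ∀ {c} → Antipalindrome c → Antipalindromeℕ c
antipalindrome⇒ℕ {c} ap i j i+j+1≡n ci≡cj = ap f (begin
  lookup c f            ≡⟨ lookup≡‼ c f (toℕ-fromℕ< i<n) ⟩
  c ‼ i                 ≡⟨ ci≡cj ⟩
  c ‼ j                 ≡⟨ lookup≡‼ c (opposite f) (toℕ-opposite f (toℕ-fromℕ< i<n) i+j+1≡n) ⟨
  lookup c (opposite f) ∎)
  where
  open ≡-Reasoning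
  i<n : i < length c
  i<n = 1+m+n≡o⇒m<o i j i+j+1≡n
  f : Fin (length c)
  f = fromℕ< i<n

ℕ⇒antipalindrome : ∀ {c} → Antipalindromeℕ c → Antipalindrome c
ℕ⇒antipalindrome {c} ap f cf≡cf′ = ap (toℕ f) (toℕ (opposite f)) (toℕ+toℕ-opposite f) (begin
  c ‼ toℕ f              ≡⟨ lookup≡‼ c f refl ⟨
  lookup c f             ≡⟨ cf≡cf′ ⟩
  lookup c (opposite f)  ≡⟨ lookup≡‼ c (opposite f) refl ⟩
  c ‼ toℕ (opposite f)   ∎)
  where open ≡-Reasoning

antipalindromeℕ-∷-∷ʳ⁺ : x ≢ y → Antipalindromeℕ v → Antipalindromeℕ (x ∷ v ∷ʳ y)
antipalindromeℕ-∷-∷ʳ⁺ {x} {y} {v} x≢y ap i j i+j+1≡n =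
  mirror i j (trans i+j+1≡n (cong suc (length-∷ʳ v)))
  where
  x≢last : ∀ j → suc j ≡ suc (suc (length v)) → x ≢ (x ∷ v ∷ʳ y) ‼ j
  x≢last _ refl x≡c‼j = x≢y (trans x≡c‼j (‼-∷ʳ-length v))

  mirror : ∀ i j → suc (i + j) ≡ suc (suc (length v)) → (x ∷ v ∷ʳ y) ‼ i ≢ (x ∷ v ∷ʳ y) ‼ j
  mirror zero    j       eq   = x≢last j eq
  mirror (suc i) zero    eq   = ≢-sym (x≢last (suc i) (trans (cong suc (+-comm 0 (suc i))) eq))
  mirror (suc i) (suc j) eq   = λ ci≡cj →
    ap i j i+j+1≡m (trans (sym (‼-∷ʳ-< v (1+m+n≡o⇒m<o i j i+j+1≡m)))
                   (trans ci≡cj (‼-∷ʳ-< v (1+m+n≡o⇒n<o i j i+j+1≡m))))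
    where
    i+j+1≡m : suc (i + j) ≡ length v
    i+j+1≡m = trans (sym (+-suc i j)) (cong (pred ∘ pred) eq)

antipalindromeℕ-∷-∷ʳ⁻ : Antipalindromeℕ (x ∷ v ∷ʳ y) → Antipalindromeℕ v
antipalindromeℕ-∷-∷ʳ⁻ {x} {v} {y} ap i j i+j+1≡m ci≡cj =
  ap (suc i) (suc j) i+j+1≡n
     (trans (‼-∷ʳ-< v (1+m+n≡o⇒m<o i j i+j+1≡m))
     (trans ci≡cj (sym (‼-∷ʳ-< v (1+m+n≡o⇒n<o i j i+j+1≡m)))))
  where
  i+j+1≡n : suc (suc i + suc j) ≡ length (x ∷ v ∷ʳ y)
  i+j+1≡n = trans (cong (suc ∘ suc) (trans (+-suc i j) i+j+1≡m))
                  (sym (cong suc (length-∷ʳ v)))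

antipalindrome-∷-∷ʳ⁺ : x ≢ y → Antipalindrome v → Antipalindrome (x ∷ v ∷ʳ y)
antipalindrome-∷-∷ʳ⁺ {v = v} x≢y ap =
  ℕ⇒antipalindrome (antipalindromeℕ-∷-∷ʳ⁺ x≢y (antipalindrome⇒ℕ {v} ap))

antipalindrome-∷-∷ʳ⁻ : Antipalindrome (x ∷ v ∷ʳ y) → Antipalindrome v
antipalindrome-∷-∷ʳ⁻ {x} {v} {y} ap =
  ℕ⇒antipalindrome {v} (antipalindromeℕ-∷-∷ʳ⁻ {x} {v} {y} (antipalindrome⇒ℕ ap))

¬antipalindrome-[x] : ¬ Antipalindrome (x ∷ [])
¬antipalindrome-[x] ap = ap Fin.zero refl

lastOnly : ∀ n → Vec Bool (suc n)
lastOnly zero    = true ∷ []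
lastOnly (suc n) = false ∷ lastOnly n

last-lastOnly : ∀ n → last (lastOnly n) ≡ true
last-lastOnly zero    = refl
last-lastOnly (suc n) = last-lastOnly n

keep-lastOnly : ∀ (w : Vec Letter (suc n)) → keep (lastOnly n) w ≡ last w ∷ []
keep-lastOnly {zero}  (_ ∷ []) = refl
keep-lastOnly {suc n} (_ ∷ w)  = keep-lastOnly w

deleted-lastOnly : ∀ n → deleted (lastOnly n) ≡ n
deleted-lastOnly zero    = refl
deleted-lastOnly (suc n) = cong suc (deleted-lastOnly n)

deleted-keep≡[] : ∀ (m : Vec Bool n) (w : Vec Letter n) → keep m w ≡ [] → deleted m ≡ n
deleted-keep≡[] []          []      _  = refl
deleted-keep≡[] (false ∷ m) (_ ∷ w) eq = cong suc (deleted-keep≡[] m w eq)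

unkeep-first : ∀ (m : Vec Bool n) (w : Vec Letter n) → keep m w ≡ x ∷ u →
  ∃ λ m′ → keep m′ w ≡ u × deleted m′ ≡ suc (deleted m)
unkeep-first []          []      ()
unkeep-first (true  ∷ m) (_ ∷ w) eq = false ∷ m , ∷-injectiveʳ eq , refl
unkeep-first (false ∷ m) (_ ∷ w) eq with unkeep-first m w eq
... | m′ , keep≡u , deleted≡ = false ∷ m′ , keep≡u , cong suc deleted≡

keep-first : ∀ (m : Vec Bool (suc n)) (w : Vec Letter (suc n)) → keep m w ≡ x ∷ u →
  ∃ λ m′ → head m′ ≡ true × keep m′ w ≡ head w ∷ u × deleted m′ ≡ deleted m
keep-first (true  ∷ m) (z ∷ w) eq = true ∷ m , refl , cong (z ∷_) (∷-injectiveʳ eq) , refl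
keep-first (false ∷ m) (z ∷ w) eq with unkeep-first m w eq
... | m′ , keep≡u , deleted≡ = true ∷ m′ , refl , cong (z ∷_) keep≡u , deleted≡

keep-last : ∀ (m : Vec Bool (suc n)) (w : Vec Letter (suc n)) (u : Word) → keep m w ≡ u ∷ʳ y →
  ∃ λ m′ → last m′ ≡ true × keep m′ w ≡ u ∷ʳ last w × deleted m′ ≡ deleted m
keep-last {zero} (true ∷ []) (z ∷ []) u eq with refl ← ∷ʳ-injectiveˡ [] u eq =
  true ∷ [] , refl , refl , refl
keep-last {zero} (false ∷ []) (z ∷ []) u eq with () ← ++-conicalʳ u _ (sym eq)
keep-last {suc n} (false ∷ m) (z ∷ w) u eq with keep-last m w u eq
... | m′ , last≡true , keep≡ , deleted≡ = false ∷ m′ , last≡true , keep≡ , cong suc deleted≡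
keep-last {suc n} (true ∷ m) (z ∷ w) [] eq =
  false ∷ lastOnly n , last-lastOnly n , keep-lastOnly w ,
  trans (cong suc (deleted-lastOnly n)) (sym (deleted-keep≡[] m w (∷-injectiveʳ eq)))
keep-last {suc n} (true ∷ m) (z ∷ w) (u₀ ∷ u) eq with refl , eq′ ← ∷-injective eq
                                                  with keep-last m w u eq′
... | m′ , last≡true , keep≡ , deleted≡ = true ∷ m′ , last≡true , cong (z ∷_) keep≡ , deleted≡

keep-ends : ∀ (m : Vec Bool (suc (suc n))) (w : Vec Letter (suc (suc n))) → keep m w ≡ x ∷ v ∷ʳ y →
  ∃ λ m′ → head m′ ≡ true × last m′ ≡ true × keep m′ w ≡ head w ∷ v ∷ʳ last w × deleted m′ ≡ deleted m
keep-ends {v = v} m (z ∷ w) eq with keep-first m (z ∷ w) eq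
... | true ∷ m₁ , refl , keep≡ , deleted≡ with keep-last m₁ w v (∷-injectiveʳ keep≡)
... | m₂ , last≡true , keep≡′ , deleted≡′ =
  true ∷ m₂ , refl , last≡true , cong (z ∷_) keep≡′ , trans deleted≡′ deleted≡

lemma3 : ∀ {n} (w : Vec Letter (suc n)) → head w ≢ last w →
    ∀ (k : ℕ) (m : Vec Bool (suc n)) → deleted m ≡ k → Antipalindrome (keep m w) →
    ∃ λ (m′ : Vec Bool (suc n)) → deleted m′ ≤ k × Antipalindrome (keep m′ w)
      × head m′ ≡ true × last m′ ≡ true
lemma3 {zero} (_ ∷ []) a₁≢aₙ _ _ _ _ = ⊥-elim (a₁≢aₙ refl)
lemma3 {suc n} w@(z ∷ ws) a₁≢aₙ _ m refl ap with keep m w in eq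
... | [] = true ∷ lastOnly n , fewer-deletions ,
  subst Antipalindrome (sym (cong (z ∷_) (keep-lastOnly ws)))
    (antipalindrome-∷-∷ʳ⁺ {v = []} a₁≢aₙ λ ()) ,
  refl , last-lastOnly n
  where
  open ≤-Reasoning
  fewer-deletions : deleted (lastOnly n) ≤ deleted m
  fewer-deletions = begin
    deleted (lastOnly n) ≡⟨ deleted-lastOnly n ⟩
    n                    ≤⟨ m≤n+m n 2 ⟩
    suc (suc n)          ≡⟨ deleted-keep≡[] m w eq ⟨
    deleted m            ∎
... | _ ∷ u with initLast u
...   | [] = ⊥-elim (¬antipalindrome-[x] ap)
...   | _ ∷ʳ′ _ with keep-ends m w eq
...     | m′ , head≡true , last≡true , keep≡ , deleted≡ =
  m′ , ≤-reflexive deleted≡ ,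
  subst Antipalindrome (sym keep≡) (antipalindrome-∷-∷ʳ⁺ a₁≢aₙ (antipalindrome-∷-∷ʳ⁻ ap)) ,
  head≡true , last≡true
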